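{- Let $T_1=\{12,1\overline{2},\overline{1}2\}$. Then $b_n(T_1\cup\{\overline{1}\,\overline{2}\})=2^n$ for every $n\ge 0$, and $b_n(T_1\cup\{\overline{2}\,\overline{1}\})=1+\binom{n+1}{2}$ for every $n\ge 2$.
   Context: A signed permutation of length $n$ is a word $\alpha=\alpha_1\cdots\alpha_n$ in which each of the symbols $1,\dots,n$ appears exactly once, each occurrence possibly barred (written $\overline{i}$). The set of all of them is $B_n$, and $B_0$ consists of the empty word. For a symbol $x$, $|x|$ denotes the underlying number with any bar removed. For $\tau=\tau_1\cdots\tau_k\in B_k$ and $\alpha\in B_n$, $\alpha$ contains $\tau$ if there are indices $1\le i_1<\cdots<i_k\le n$ such that (1) $|\alpha_{i_p}|>|\alpha_{i_q}|$ if and only if $|\tau_p|>|\tau_q|$ for all $p,q$, and (2) $\alpha_{i_j}$ is barred if and only if $\tau_j$ is barred for every $j$. Otherwise $\alpha$ avoids $\tau$. $B_n(T)$ is the set of $\alpha\in B_n$ avoiding every pattern in $T$, and $b_n(T)=|B_n(T)|$. -}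

module Defs where

open import Data.Nat using (ℕ)
open import Data.Bool using (Bool; true; false)
open import Data.Fin using (Fin; zero; suc; _<_)
open import Data.Vec using (Vec; lookup; []; _∷_)
open import Data.List using (List; _∷_; [])
open import Data.List.Relation.Unary.All using (All)
open import Data.Product using (Σ; ∃; _×_; _,_; proj₁; proj₂)
open import Relation.Binary.PropositionalEquality using (_≡_)
open import Relation.Nullary using (¬_)
open import Function.Bundles using (_⇔_)
open import Function.Definitions using (Injective)

-- A letter of a signed word: (barred?, underlying value |x|).
-- Value (k : Fin n) stands for the symbol k+1 ∈ {1,…,n}.
Letter : ℕ → Set
Letter n = Bool × Fin n

barred : ∀ {n} → Letter n → Bool
barred = proj₁

∣_∣ₗ : ∀ {n} → Letter n → Fin n
∣_∣ₗ = proj₂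

Word : ℕ → Set
Word n = Vec (Letter n) n

-- α is a signed permutation: each symbol 1..n appears exactly once
-- (n letters with pairwise distinct values from an n-element set).
IsSignedPerm : ∀ {n} → Word n → Set
IsSignedPerm {n} α = ∀ (i j : Fin n) → ∣ lookup α i ∣ₗ ≡ ∣ lookup α j ∣ₗ → i ≡ j

Contains : ∀ {n k} → Word n → Word k → Set
Contains {n} {k} α τ =
  Σ (Fin k → Fin n) λ ι →
    (∀ (p q : Fin k) → p < q → ι p < ι q) ×
    (∀ (p q : Fin k) →
       (∣ lookup α (ι q) ∣ₗ < ∣ lookup α (ι p) ∣ₗ) ⇔ (∣ lookup τ q ∣ₗ < ∣ lookup τ p ∣ₗ)) ×
    (∀ (j : Fin k) → barred (lookup α (ι j)) ≡ barred (lookup τ j))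

Pattern : Set
Pattern = Σ ℕ Word

Avoids : ∀ {n} → Word n → Pattern → Set
Avoids α (k , τ) = ¬ Contains α τ

InB : (n : ℕ) → List Pattern → Word n → Set
InB n T α = IsSignedPerm α × All (Avoids α) T

HasCard : {A : Set} → (A → Set) → ℕ → Set
HasCard {A} P k =
  Σ (Fin k → A) λ f →
    Injective _≡_ _≡_ f × (∀ i → P (f i)) × (∀ a → P a → ∃ λ i → f i ≡ a)

bCount : ℕ → List Pattern → ℕ → Set
bCount n T k = HasCard (InB n T) k

-- Patterns of length 2 (values: zero = 1, suc zero = 2; true = barred).
p12 p1b2 pb12 pb1b2 pb2b1 : Pattern
p12   = 2 , ((false , zero) ∷ (false , suc zero) ∷ [])
p1b2  = 2 , ((false , zero) ∷ (true  , suc zero) ∷ [])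
pb12  = 2 , ((true  , zero) ∷ (false , suc zero) ∷ [])
pb1b2 = 2 , ((true  , zero) ∷ (true  , suc zero) ∷ [])
pb2b1 = 2 , ((true  , suc zero) ∷ (true  , zero) ∷ [])

T₁ : List Pattern
T₁ = p12 ∷ p1b2 ∷ pb12 ∷ []

-- Avoiding 12, 12̄ and 1̄2 means that every ascent of a signed permutation joins two barred
-- letters. Adding 1̄2̄ leaves no ascent at all, so the letters read n ⋯ 2 1 with arbitrary bars:
-- 2ⁿ words. Adding 2̄1̄ instead makes two letters an ascent exactly when both are barred; then the
-- barred positions form an interval [s, e), and the letters read n ⋯ 2 1 with that interval
-- reversed: one word without bars and C(n+1, 2) with a nonempty interval. In both cases the values
-- are forced by the ascents, because the value of a letter in a permutation is its rank, the number
-- of smaller letters, and the ranks are determined by the relative order.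

module Submission where

open import Defs
open import Data.Nat using (ℕ; zero; suc; _+_; _^_; _∸_; _≤_; _<_; z≤n; s≤s; _<?_; _≤ᵇ_; _<ᵇ_)
open import Data.Nat.Properties
open import Data.Nat.Combinatorics using (_C_; nC1≡n; nCk+nC[k+1]≡[n+1]C[k+1])
open import Data.Fin as Fin using (Fin; zero; suc; toℕ; fromℕ<)
open import Data.Fin.Properties
  using (¬Fin0; toℕ-injective; toℕ<n; toℕ-fromℕ<; injective⇒≤; join-splitAt; splitAt-↑ˡ; splitAt-↑ʳ)
open import Data.Bool using (Bool; true; false; not; _∧_; if_then_else_)
open import Data.Vec using (Vec; []; _∷_; lookup; map; tabulate)
open import Data.Vec.Properties using (lookup-map; lookup∘tabulate; tabulate∘lookup; tabulate-cong)
open import Data.List using (_∷ʳ_)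
open import Data.List.Relation.Unary.All using (All; []; _∷_)
open import Data.Product using (∃; ∃₂; _×_; _,_; proj₁; proj₂)
open import Data.Sum using (_⊎_; inj₁; inj₂)
open import Data.Unit using (⊤; tt)
open import Data.Empty using (⊥-elim)
open import Function using (_∘_)
open import Function.Bundles using (_⇔_; mk⇔; Equivalence)
open import Relation.Nullary using (¬_; yes; no)
open import Relation.Nullary.Reflects using (ofʸ; ofⁿ)
open import Relation.Nullary.Decidable using (¬?)
open import Relation.Unary using (Decidable)
open import Relation.Binary.Definitions using (tri<; tri≈; tri>)
open import Relation.Binary.PropositionalEquality

private
  variable
    A B : Set
    k m n : ℕ

-- Cardinalities of finite sets

HasCard-cong : {P Q : A → Set} → (∀ a → P a ⇔ Q a) → HasCard P k → HasCard Q k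
HasCard-cong P⇔Q (f , f-inj , f∈P , P⊆f) =
  f , f-inj , (λ i → Equivalence.to (P⇔Q (f i)) (f∈P i)) , (λ a qa → P⊆f a (Equivalence.from (P⇔Q a) qa))

HasCard-image : {P : A → Set} (h : A → B) → (∀ {a a′} → P a → P a′ → h a ≡ h a′ → a ≡ a′) →
                HasCard P k → HasCard (λ b → ∃ λ a → P a × h a ≡ b) k
HasCard-image {P = P} h h-inj (f , f-inj , f∈P , P⊆f) =
  h ∘ f , (λ eq → f-inj (h-inj (f∈P _) (f∈P _) eq)) , (λ i → f i , f∈P i , refl) , onto
  where
  onto : ∀ b → (∃ λ a → P a × h a ≡ b) → ∃ λ i → h (f i) ≡ b
  onto _ (a , pa , refl) with P⊆f a pa
  ... | i , fi≡a = i , cong h fi≡a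

HasCard-∅ : {P : A → Set} → (∀ a → ¬ P a) → HasCard P 0
HasCard-∅ ¬P = (λ ()) , (λ {i} → ⊥-elim (¬Fin0 i)) , (λ ()) , (λ a pa → ⊥-elim (¬P a pa))

HasCard-singleton : (a : A) → HasCard (_≡ a) 1
HasCard-singleton a = (λ _ → a) , (λ { {zero} {zero} _ → refl }) , (λ _ → refl) , (λ _ b≡a → zero , sym b≡a)

HasCard-⊎ : {P Q : A → Set} → (∀ a → P a → ¬ Q a) → HasCard P m → HasCard Q k →
            HasCard (λ a → P a ⊎ Q a) (m + k)
HasCard-⊎ {A = A} {m = m} {k = k} {P = P} {Q = Q} disjoint (f , f-inj , f∈P , P⊆f) (g , g-inj , g∈Q , Q⊆g) =
  [f,g] ∘ Fin.splitAt m , inj , (λ i → mem (Fin.splitAt m i)) , onto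
  where
  [f,g] : Fin m ⊎ Fin k → A
  [f,g] (inj₁ i) = f i
  [f,g] (inj₂ j) = g j
  [f,g]-inj : ∀ u v → [f,g] u ≡ [f,g] v → u ≡ v
  [f,g]-inj (inj₁ i) (inj₁ j) eq = cong inj₁ (f-inj eq)
  [f,g]-inj (inj₁ i) (inj₂ j) eq = ⊥-elim (disjoint _ (f∈P i) (subst Q (sym eq) (g∈Q j)))
  [f,g]-inj (inj₂ i) (inj₁ j) eq = ⊥-elim (disjoint _ (f∈P j) (subst Q eq (g∈Q i)))
  [f,g]-inj (inj₂ i) (inj₂ j) eq = cong inj₂ (g-inj eq)
  inj : ∀ {i j} → [f,g] (Fin.splitAt m i) ≡ [f,g] (Fin.splitAt m j) → i ≡ j
  inj {i} {j} eq = subst₂ _≡_ (join-splitAt m k i) (join-splitAt m k j)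
                              (cong (Fin.join m k) ([f,g]-inj (Fin.splitAt m i) (Fin.splitAt m j) eq))
  mem : ∀ u → P ([f,g] u) ⊎ Q ([f,g] u)
  mem (inj₁ i) = inj₁ (f∈P i)
  mem (inj₂ j) = inj₂ (g∈Q j)
  onto : ∀ a → P a ⊎ Q a → ∃ λ i → [f,g] (Fin.splitAt m i) ≡ a
  onto a (inj₁ pa) with P⊆f a pa
  ... | i , fi≡a = i Fin.↑ˡ k , trans (cong [f,g] (splitAt-↑ˡ m i k)) fi≡a
  onto a (inj₂ qa) with Q⊆g a qa
  ... | j , gj≡a = m Fin.↑ʳ j , trans (cong [f,g] (splitAt-↑ʳ m k j)) gj≡a

HasCard-≤ : {P : A → Set} (h : A → ℕ) → (∀ {a a′} → P a → P a′ → h a ≡ h a′ → a ≡ a′) →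
            (∀ {a} → P a → h a < m) → HasCard P k → k ≤ m
HasCard-≤ h h-inj h<m (f , f-inj , f∈P , _) =
  injective⇒≤ {f = λ i → fromℕ< (h<m (f∈P i))}
    (λ eq → f-inj (h-inj (f∈P _) (f∈P _) (subst₂ _≡_ (toℕ-fromℕ< _) (toℕ-fromℕ< _) (cong toℕ eq))))

HasCard-< : ∀ m → HasCard (_< m) m
HasCard-< m = toℕ , toℕ-injective , toℕ<n , λ x x<m → fromℕ< x<m , toℕ-fromℕ< x<m

HasCard-Vec : ∀ n → HasCard {Vec Bool n} (λ _ → ⊤) (2 ^ n)
HasCard-Vec zero = HasCard-cong (λ { [] → mk⇔ (λ _ → tt) (λ _ → refl) }) (HasCard-singleton [])
HasCard-Vec (suc n) = subst (HasCard _) (cong (2 ^ n +_) (sym (+-identityʳ (2 ^ n))))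
  (HasCard-cong split (HasCard-⊎ (λ { _ (_ , _ , refl) (_ , _ , ()) }) (headed true) (headed false)))
  where
  headed : ∀ b → HasCard (λ v → ∃ λ u → ⊤ × b ∷ u ≡ v) (2 ^ n)
  headed b = HasCard-image (b ∷_) (λ { _ _ refl → refl }) (HasCard-Vec n)
  split : ∀ v → ((∃ λ u → ⊤ × true ∷ u ≡ v) ⊎ (∃ λ u → ⊤ × false ∷ u ≡ v)) ⇔ ⊤
  split (true ∷ u) = mk⇔ (λ _ → tt) (λ _ → inj₁ (u , tt , refl))
  split (false ∷ u) = mk⇔ (λ _ → tt) (λ _ → inj₂ (u , tt , refl))

-- Ranks and ascent sets

count : {P : ℕ → Set} → Decidable P → ℕ → ℕ
count P? zero = zero
count P? (suc n) with P? n
... | yes _ = suc (count P? n)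
... | no _ = count P? n

HasCard-count : {P : ℕ → Set} (P? : Decidable P) → ∀ n → HasCard (λ x → x < n × P x) (count P? n)
HasCard-count P? zero = HasCard-∅ (λ _ ())
HasCard-count {P} P? (suc n) with P? n
... | yes pn = HasCard-cong (λ x → mk⇔ (to x) (from x))
                 (HasCard-⊎ (λ { _ refl (n<n , _) → n≮n n n<n }) (HasCard-singleton n) (HasCard-count P? n))
  where
  to : ∀ x → x ≡ n ⊎ (x < n × P x) → x < suc n × P x
  to _ (inj₁ refl) = n<1+n n , pn
  to x (inj₂ (x<n , px)) = m<n⇒m<1+n x<n , px
  from : ∀ x → x < suc n × P x → x ≡ n ⊎ (x < n × P x)
  from x (x<1+n , px) with m<1+n⇒m<n∨m≡n x<1+n
  ... | inj₁ x<n = inj₂ (x<n , px)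
  ... | inj₂ x≡n = inj₁ x≡n
... | no ¬pn = HasCard-cong (λ x → mk⇔ (λ (x<n , px) → m<n⇒m<1+n x<n , px) (from x)) (HasCard-count P? n)
  where
  from : ∀ x → x < suc n × P x → x < n × P x
  from x (x<1+n , px) with m<1+n⇒m<n∨m≡n x<1+n
  ... | inj₁ x<n = x<n , px
  ... | inj₂ refl = ⊥-elim (¬pn px)

count-complement : {P : ℕ → Set} (P? : Decidable P) → ∀ n → count P? n + count (¬? ∘ P?) n ≡ n
count-complement P? zero = refl
count-complement P? (suc n) with P? n
... | yes _ = cong suc (count-complement P? n)
... | no _ = trans (+-suc _ _) (cong suc (count-complement P? n))

count-cong : {P Q : ℕ → Set} (P? : Decidable P) (Q? : Decidable Q) →
             (∀ {x} → x < n → P x ⇔ Q x) → count P? n ≡ count Q? n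
count-cong {n = zero} P? Q? P⇔Q = refl
count-cong {n = suc n} P? Q? P⇔Q with P? n | Q? n
... | yes _ | yes _ = cong suc (count-cong P? Q? (P⇔Q ∘ m<n⇒m<1+n))
... | no _ | no _ = count-cong P? Q? (P⇔Q ∘ m<n⇒m<1+n)
... | yes pn | no ¬qn = ⊥-elim (¬qn (Equivalence.to (P⇔Q (n<1+n n)) pn))
... | no ¬pn | yes qn = ⊥-elim (¬pn (Equivalence.from (P⇔Q (n<1+n n)) qn))

InjectiveBelow : ℕ → (ℕ → ℕ) → Set
InjectiveBelow n f = ∀ {x y} → x < n → y < n → f x ≡ f y → x ≡ y

rank : (ℕ → ℕ) → ℕ → ℕ → ℕ
rank f n x = count (λ y → f y <? f x) n

-- Pigeonhole twice: f maps the positions counted by the rank into [0, f x), the others into [f x, n).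
≡rank : ∀ {f x} → InjectiveBelow n f → (∀ {y} → y < n → f y < n) → x < n → f x ≡ rank f n x
≡rank {n} {f} {x} f-inj f<n x<n = ≤-antisym fx≤rank rank≤fx
  where
  P? = λ y → f y <? f x
  rank≤fx : rank f n x ≤ f x
  rank≤fx = HasCard-≤ f (λ (y<n , _) (z<n , _) → f-inj y<n z<n) proj₂ (HasCard-count P? n)
  rest≤ : count (¬? ∘ P?) n ≤ n ∸ f x
  rest≤ = HasCard-≤ (λ y → f y ∸ f x)
    (λ (y<n , fy≮fx) (z<n , fz≮fx) eq → f-inj y<n z<n (∸-cancelʳ-≡ (≮⇒≥ fy≮fx) (≮⇒≥ fz≮fx) eq))
    (λ (y<n , fy≮fx) → ∸-monoˡ-< (f<n y<n) (≮⇒≥ fy≮fx))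
    (HasCard-count (¬? ∘ P?) n)
  fx≤rank : f x ≤ rank f n x
  fx≤rank = +-cancelʳ-≤ (count (¬? ∘ P?) n) (f x) (rank f n x) (begin
    f x + count (¬? ∘ P?) n ≤⟨ +-monoʳ-≤ (f x) rest≤ ⟩
    f x + (n ∸ f x)         ≡⟨ m+[n∸m]≡n (<⇒≤ (f<n x<n)) ⟩
    n                       ≡⟨ sym (count-complement P? n) ⟩
    rank f n x + count (¬? ∘ P?) n ∎)
    where open ≤-Reasoning

n<n⇔m<m : ∀ {m n} → n < n ⇔ m < m
n<n⇔m<m = mk⇔ (λ n<n → ⊥-elim (n≮n _ n<n)) (λ m<m → ⊥-elim (n≮n _ m<m))

Ordered : Bool → ℕ → ℕ → Set
Ordered true  a b = a < b
Ordered false a b = b < a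

ordered-⇔ : ∀ o {a b c d} → Ordered o a b → Ordered o c d → (a < b ⇔ c < d)
ordered-⇔ true  a<b c<d = mk⇔ (λ _ → c<d) (λ _ → a<b)
ordered-⇔ false b<a d<c = mk⇔ (λ a<b → ⊥-elim (<-asym a<b b<a)) (λ c<d → ⊥-elim (<-asym c<d d<c))

ordered-flip : ∀ o {a b} → Ordered o a b → Ordered (not o) b a
ordered-flip true  a<b = a<b
ordered-flip false b<a = b<a

ordered-unique : ∀ o o′ {a b} → Ordered o a b → Ordered o′ a b → o ≡ o′
ordered-unique true  true  _   _   = refl
ordered-unique false false _   _   = refl
ordered-unique true  false a<b b<a = ⊥-elim (<-asym a<b b<a)
ordered-unique false true  b<a a<b = ⊥-elim (<-asym a<b b<a)

ordered⇒≢ : ∀ o {a b} → Ordered o a b → a ≢ b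
ordered⇒≢ true  a<b refl = n≮n _ a<b
ordered⇒≢ false b<a refl = n≮n _ b<a

≢⇒ordered : ∀ o {a b} → a ≢ b → Ordered o a b ⊎ Ordered (not o) a b
≢⇒ordered o {a} {b} a≢b with <-cmp a b | o
... | tri< a<b _ _ | true  = inj₁ a<b
... | tri< a<b _ _ | false = inj₂ a<b
... | tri> _ _ b<a | true  = inj₂ b<a
... | tri> _ _ b<a | false = inj₁ b<a
... | tri≈ _ a≡b _ | _     = ⊥-elim (a≢b a≡b)

record HasAscentSet (asc : ℕ → ℕ → Bool) (f : ℕ → ℕ) (n : ℕ) : Set where
  constructor hasAscentSet
  field
    ordered : ∀ {x y} → x < y → y < n → Ordered (asc x y) (f x) (f y)

open HasAscentSet

hasAscentSet⇒injective : ∀ {asc f} → HasAscentSet asc f n → InjectiveBelow n f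
hasAscentSet⇒injective ascents {x} {y} x<n y<n fx≡fy with <-cmp x y
... | tri< x<y _ _ = ⊥-elim (ordered⇒≢ _ (ordered ascents x<y y<n) fx≡fy)
... | tri≈ _ x≡y _ = x≡y
... | tri> _ _ y<x = ⊥-elim (ordered⇒≢ _ (ordered ascents y<x x<n) (sym fx≡fy))

HasAscentSet-congˡ : ∀ {asc asc′ f} → (∀ {x y} → x < y → y < n → asc x y ≡ asc′ x y) →
                     HasAscentSet asc f n → HasAscentSet asc′ f n
HasAscentSet-congˡ {f = f} asc≡asc′ ascents = hasAscentSet λ {x} {y} x<y y<n →
  subst (λ o → Ordered o (f x) (f y)) (asc≡asc′ x<y y<n) (ordered ascents x<y y<n)

HasAscentSet-congʳ : ∀ {asc f g} → (∀ {x} → x < n → f x ≡ g x) →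
                     HasAscentSet asc f n → HasAscentSet asc g n
HasAscentSet-congʳ {asc = asc} f≡g ascents = hasAscentSet λ {x} {y} x<y y<n →
  subst₂ (Ordered (asc x y)) (f≡g (<-trans x<y y<n)) (f≡g y<n) (ordered ascents x<y y<n)

bothBarred : (ℕ → Bool) → ℕ → ℕ → Bool
bothBarred b x y = b x ∧ b y

HasAscentSet-bothBarred-cong : ∀ {b b′ f} → (∀ {x} → x < n → b x ≡ b′ x) →
                               HasAscentSet (bothBarred b) f n → HasAscentSet (bothBarred b′) f n
HasAscentSet-bothBarred-cong b≡b′ =
  HasAscentSet-congˡ λ x<y y<n → cong₂ _∧_ (b≡b′ (<-trans x<y y<n)) (b≡b′ y<n)

hasAscentSet-unique : ∀ {asc f g} → HasAscentSet asc f n → HasAscentSet asc g n →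
                      (∀ {x} → x < n → f x < n) → (∀ {x} → x < n → g x < n) →
                      ∀ {x} → x < n → f x ≡ g x
hasAscentSet-unique {n} {f = f} {g} f-asc g-asc f<n g<n {x} x<n = begin
  f x        ≡⟨ ≡rank (hasAscentSet⇒injective f-asc) f<n x<n ⟩
  rank f n x ≡⟨ count-cong _ _ same-order ⟩
  rank g n x ≡⟨ ≡rank (hasAscentSet⇒injective g-asc) g<n x<n ⟨
  g x        ∎
  where
  open ≡-Reasoning
  same-order : ∀ {y} → y < n → f y < f x ⇔ g y < g x
  same-order {y} y<n with <-cmp y x
  ... | tri< y<x _ _ = ordered-⇔ _ (ordered f-asc y<x x<n) (ordered g-asc y<x x<n)
  ... | tri≈ _ refl _ = n<n⇔m<m
  ... | tri> _ _ x<y =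
    ordered-⇔ _ (ordered-flip _ (ordered f-asc x<y y<n)) (ordered-flip _ (ordered g-asc x<y y<n))

lookupℕ : A → Vec A n → ℕ → A
lookupℕ d []      _       = d
lookupℕ d (a ∷ v) zero    = a
lookupℕ d (a ∷ v) (suc x) = lookupℕ d v x

lookupℕ-toℕ : ∀ d (v : Vec A n) i → lookupℕ d v (toℕ i) ≡ lookup v i
lookupℕ-toℕ d (a ∷ v) zero    = refl
lookupℕ-toℕ d (a ∷ v) (suc i) = lookupℕ-toℕ d v i

lookupℕ-fromℕ< : ∀ d (v : Vec A n) {x} (x<n : x < n) → lookupℕ d v x ≡ lookup v (fromℕ< x<n)
lookupℕ-fromℕ< d (a ∷ v) {zero}  _         = refl
lookupℕ-fromℕ< d (a ∷ v) {suc x} (s≤s x<n) = lookupℕ-fromℕ< d v x<n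

lookupℕ-injective : ∀ {d} {u v : Vec A n} → (∀ {x} → x < n → lookupℕ d u x ≡ lookupℕ d v x) → u ≡ v
lookupℕ-injective {u = []}    {[]}    _    = refl
lookupℕ-injective {u = a ∷ u} {b ∷ v} same = cong₂ _∷_ (same (s≤s z≤n)) (lookupℕ-injective (same ∘ s≤s))

-- Positions ≥ n read as an unbarred letter of value 0.
bar : Word n → ℕ → Bool
bar α = lookupℕ false (map barred α)

value : Word n → ℕ → ℕ
value α = lookupℕ 0 (map (toℕ ∘ ∣_∣ₗ) α)

module _ (α : Word n) where

  bar-toℕ : ∀ i → bar α (toℕ i) ≡ barred (lookup α i)
  bar-toℕ i = trans (lookupℕ-toℕ false (map barred α) i) (lookup-map i barred α)

  value-toℕ : ∀ i → value α (toℕ i) ≡ toℕ ∣ lookup α i ∣ₗ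
  value-toℕ i = trans (lookupℕ-toℕ 0 (map (toℕ ∘ ∣_∣ₗ) α) i) (lookup-map i (toℕ ∘ ∣_∣ₗ) α)

  bar-fromℕ< : ∀ {x} (x<n : x < n) → bar α x ≡ barred (lookup α (fromℕ< x<n))
  bar-fromℕ< x<n = trans (lookupℕ-fromℕ< false (map barred α) x<n) (lookup-map (fromℕ< x<n) barred α)

  value-fromℕ< : ∀ {x} (x<n : x < n) → value α x ≡ toℕ ∣ lookup α (fromℕ< x<n) ∣ₗ
  value-fromℕ< x<n =
    trans (lookupℕ-fromℕ< 0 (map (toℕ ∘ ∣_∣ₗ) α) x<n) (lookup-map (fromℕ< x<n) (toℕ ∘ ∣_∣ₗ) α)

  value<n : ∀ {x} → x < n → value α x < n
  value<n x<n = subst (_< n) (sym (value-fromℕ< x<n)) (toℕ<n _)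

  IsSignedPerm⇒injective : IsSignedPerm α → InjectiveBelow n (value α)
  IsSignedPerm⇒injective perm x<n y<n eq =
    subst₂ _≡_ (toℕ-fromℕ< x<n) (toℕ-fromℕ< y<n)
      (cong toℕ (perm _ _ (toℕ-injective (trans (sym (value-fromℕ< x<n)) (trans eq (value-fromℕ< y<n))))))

  injective⇒IsSignedPerm : InjectiveBelow n (value α) → IsSignedPerm α
  injective⇒IsSignedPerm inj i j eq =
    toℕ-injective (inj (toℕ<n i) (toℕ<n j) (trans (value-toℕ i) (trans (cong toℕ eq) (sym (value-toℕ j)))))

word-≡ : {α β : Word n} → (∀ {x} → x < n → bar α x ≡ bar β x) → (∀ {x} → x < n → value α x ≡ value β x) →
         α ≡ β
word-≡ {α = α} {β} same-bar same-value = begin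
  α                  ≡⟨ tabulate∘lookup α ⟨
  tabulate (lookup α) ≡⟨ tabulate-cong same-letter ⟩
  tabulate (lookup β) ≡⟨ tabulate∘lookup β ⟩
  β                  ∎
  where
  open ≡-Reasoning
  same-letter : ∀ i → lookup α i ≡ lookup β i
  same-letter i = cong₂ _,_
    (trans (sym (bar-toℕ α i)) (trans (same-bar (toℕ<n i)) (bar-toℕ β i)))
    (toℕ-injective (trans (sym (value-toℕ α i)) (trans (same-value (toℕ<n i)) (value-toℕ β i))))

opaque
  wordOf : (b : ℕ → Bool) (f : ℕ → ℕ) → (∀ {x} → x < n → f x < n) → Word n
  wordOf b f f<n = tabulate λ i → b (toℕ i) , fromℕ< (f<n (toℕ<n i))

opaque
  unfolding wordOf

  bar-wordOf : ∀ {b f} (f<n : ∀ {x} → x < n → f x < n) {x} → x < n →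
               bar (wordOf b f f<n) x ≡ b x
  bar-wordOf {b = b} {f} f<n {x} x<n = begin
    bar (wordOf b f f<n) x                        ≡⟨ bar-fromℕ< (wordOf b f f<n) x<n ⟩
    barred (lookup (wordOf b f f<n) (fromℕ< x<n)) ≡⟨ cong barred (lookup∘tabulate _ (fromℕ< x<n)) ⟩
    b (toℕ (fromℕ< x<n))                          ≡⟨ cong b (toℕ-fromℕ< x<n) ⟩
    b x                                           ∎
    where open ≡-Reasoning

  value-wordOf : ∀ {b f} (f<n : ∀ {x} → x < n → f x < n) {x} → x < n →
                 value (wordOf b f f<n) x ≡ f x
  value-wordOf {b = b} {f} f<n {x} x<n = begin
    value (wordOf b f f<n) x                     ≡⟨ value-fromℕ< (wordOf b f f<n) x<n ⟩
    toℕ ∣ lookup (wordOf b f f<n) (fromℕ< x<n) ∣ₗ ≡⟨ cong (toℕ ∘ ∣_∣ₗ) (lookup∘tabulate _ (fromℕ< x<n)) ⟩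
    toℕ (fromℕ< (f<n (toℕ<n (fromℕ< x<n))))     ≡⟨ toℕ-fromℕ< _ ⟩
    f (toℕ (fromℕ< x<n))                         ≡⟨ cong f (toℕ-fromℕ< x<n) ⟩
    f x                                          ∎
    where open ≡-Reasoning

-- Patterns of length two

-- The length-2 patterns p12, …, pb2b1 are instances of pattern₂ up to definitional equality.
pattern₂ : Bool → Bool → Bool → Word 2
pattern₂ b₀ b₁ increasing =
  (b₀ , (if increasing then zero else suc zero)) ∷ (b₁ , (if increasing then suc zero else zero)) ∷ []

pattern₂-ordered : ∀ {b₀ b₁} o →
  Ordered o (toℕ ∣ lookup (pattern₂ b₀ b₁ o) zero ∣ₗ) (toℕ ∣ lookup (pattern₂ b₀ b₁ o) (suc zero) ∣ₗ)
pattern₂-ordered true  = s≤s z≤n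
pattern₂-ordered false = s≤s z≤n

ordered-transfer : ∀ o {a b c d} → (a < b ⇔ c < d) → (b < a ⇔ d < c) → Ordered o c d → Ordered o a b
ordered-transfer true  a<b⇔c<d _       c<d = Equivalence.from a<b⇔c<d c<d
ordered-transfer false _       b<a⇔d<c d<c = Equivalence.from b<a⇔d<c d<c

Occurs : Word n → Bool → Bool → Bool → Set
Occurs {n} α b₀ b₁ o =
  ∃₂ λ x y → x < y × y < n × bar α x ≡ b₀ × bar α y ≡ b₁ × Ordered o (value α x) (value α y)

module _ {b₀ b₁ : Bool} (o : Bool) (α : Word n) where

  contains⇒occurs : Contains α (pattern₂ b₀ b₁ o) → Occurs α b₀ b₁ o
  contains⇒occurs (ι , ι-increasing , ι-order , ι-bars) =
    toℕ (ι zero) , toℕ (ι (suc zero)) , ι-increasing zero (suc zero) (s≤s z≤n) , toℕ<n _ ,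
    trans (bar-toℕ α _) (ι-bars zero) , trans (bar-toℕ α _) (ι-bars (suc zero)) ,
    subst₂ (Ordered o) (sym (value-toℕ α _)) (sym (value-toℕ α _))
      (ordered-transfer o (ι-order (suc zero) zero) (ι-order zero (suc zero)) (pattern₂-ordered {b₀} {b₁} o))

  occurs⇒contains : Occurs α b₀ b₁ o → Contains α (pattern₂ b₀ b₁ o)
  occurs⇒contains (x , y , x<y , y<n , bar-x , bar-y , xy-ordered) = ι , ι-increasing , ι-order , ι-bars
    where
    x<n = <-trans x<y y<n
    τ = pattern₂ b₀ b₁ o
    ι : Fin 2 → Fin n
    ι zero       = fromℕ< x<n
    ι (suc zero) = fromℕ< y<n
    ι-increasing : ∀ p q → p Fin.< q → ι p Fin.< ι q
    ι-increasing zero       (suc zero) _        = subst₂ _<_ (sym (toℕ-fromℕ< x<n)) (sym (toℕ-fromℕ< y<n)) x<y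
    ι-increasing (suc zero) (suc zero) (s≤s ())
    ι-ordered : Ordered o (toℕ ∣ lookup α (ι zero) ∣ₗ) (toℕ ∣ lookup α (ι (suc zero)) ∣ₗ)
    ι-ordered = subst₂ (Ordered o) (value-fromℕ< α x<n) (value-fromℕ< α y<n) xy-ordered
    τ-ordered : Ordered o (toℕ ∣ lookup τ zero ∣ₗ) (toℕ ∣ lookup τ (suc zero) ∣ₗ)
    τ-ordered = pattern₂-ordered {b₀} {b₁} o
    ι-order : ∀ p q → (∣ lookup α (ι q) ∣ₗ Fin.< ∣ lookup α (ι p) ∣ₗ) ⇔ (∣ lookup τ q ∣ₗ Fin.< ∣ lookup τ p ∣ₗ)
    ι-order zero       zero       = n<n⇔m<m
    ι-order zero       (suc zero) = ordered-⇔ (not o) (ordered-flip o ι-ordered) (ordered-flip o τ-ordered)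
    ι-order (suc zero) zero       = ordered-⇔ o ι-ordered τ-ordered
    ι-order (suc zero) (suc zero) = n<n⇔m<m
    ι-bars : ∀ j → barred (lookup α (ι j)) ≡ barred (lookup τ j)
    ι-bars zero       = trans (sym (bar-fromℕ< α x<n)) bar-x
    ι-bars (suc zero) = trans (sym (bar-fromℕ< α y<n)) bar-y

avoids-pattern₂ : ∀ {asc b₀ b₁} o (α : Word n) → HasAscentSet asc (value α) n →
                  (∀ {x y} → bar α x ≡ b₀ → bar α y ≡ b₁ → asc x y ≢ o) → ¬ Contains α (pattern₂ b₀ b₁ o)
avoids-pattern₂ o α ascents not-o contains with contains⇒occurs o α contains
... | x , y , x<y , y<n , bar-x , bar-y , xy-ordered =
  not-o bar-x bar-y (ordered-unique _ o (ordered ascents x<y y<n) xy-ordered)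

avoidance⇒hasAscentSet : ∀ asc (α : Word n) → IsSignedPerm α →
  (∀ {x y} → x < y → y < n → ¬ Contains α (pattern₂ (bar α x) (bar α y) (not (asc x y)))) →
  HasAscentSet asc (value α) n
avoidance⇒hasAscentSet {n} asc α perm avoids = hasAscentSet forced
  where
  distinct : ∀ {x y} → x < y → y < n → value α x ≢ value α y
  distinct x<y y<n eq = <-irrefl (IsSignedPerm⇒injective α perm (<-trans x<y y<n) y<n eq) x<y
  forced : ∀ {x y} → x < y → y < n → Ordered (asc x y) (value α x) (value α y)
  forced {x} {y} x<y y<n with ≢⇒ordered (asc x y) (distinct x<y y<n)
  ... | inj₁ xy-ordered = xy-ordered
  ... | inj₂ reversed   =
    ⊥-elim (avoids x<y y<n (occurs⇒contains _ α (x , y , x<y , y<n , refl , refl , reversed)))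

module _ (α : Word n) where

  InB-pb1b2⇔descending : InB n (T₁ ∷ʳ pb1b2) α ⇔ HasAscentSet (λ _ _ → false) (value α) n
  InB-pb1b2⇔descending = mk⇔ to from
    where
    avoids-increasing : All (Avoids α) (T₁ ∷ʳ pb1b2) → ∀ b₀ b₁ → ¬ Contains α (pattern₂ b₀ b₁ true)
    avoids-increasing (av ∷ _  ∷ _  ∷ _  ∷ []) false false = av
    avoids-increasing (_  ∷ av ∷ _  ∷ _  ∷ []) false true  = av
    avoids-increasing (_  ∷ _  ∷ av ∷ _  ∷ []) true  false = av
    avoids-increasing (_  ∷ _  ∷ _  ∷ av ∷ []) true  true  = av
    to : InB n (T₁ ∷ʳ pb1b2) α → HasAscentSet (λ _ _ → false) (value α) n
    to (perm , avoid) =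
      avoidance⇒hasAscentSet _ α perm λ {x} {y} _ _ → avoids-increasing avoid (bar α x) (bar α y)
    from : HasAscentSet (λ _ _ → false) (value α) n → InB n (T₁ ∷ʳ pb1b2) α
    from ascents = injective⇒IsSignedPerm α (hasAscentSet⇒injective ascents) ,
                   avoids ∷ avoids ∷ avoids ∷ avoids ∷ []
      where
      avoids : ∀ {b₀ b₁} → ¬ Contains α (pattern₂ b₀ b₁ true)
      avoids = avoids-pattern₂ true α ascents (λ _ _ ())

  InB-pb2b1⇔bothBarred : InB n (T₁ ∷ʳ pb2b1) α ⇔ HasAscentSet (bothBarred (bar α)) (value α) n
  InB-pb2b1⇔bothBarred = mk⇔ to from
    where
    avoids-forbidden : All (Avoids α) (T₁ ∷ʳ pb2b1) → ∀ b₀ b₁ → ¬ Contains α (pattern₂ b₀ b₁ (not (b₀ ∧ b₁)))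
    avoids-forbidden (av ∷ _  ∷ _  ∷ _  ∷ []) false false = av
    avoids-forbidden (_  ∷ av ∷ _  ∷ _  ∷ []) false true  = av
    avoids-forbidden (_  ∷ _  ∷ av ∷ _  ∷ []) true  false = av
    avoids-forbidden (_  ∷ _  ∷ _  ∷ av ∷ []) true  true  = av
    to : InB n (T₁ ∷ʳ pb2b1) α → HasAscentSet (bothBarred (bar α)) (value α) n
    to (perm , avoid) =
      avoidance⇒hasAscentSet _ α perm λ {x} {y} _ _ → avoids-forbidden avoid (bar α x) (bar α y)
    from : HasAscentSet (bothBarred (bar α)) (value α) n → InB n (T₁ ∷ʳ pb2b1) α
    from ascents = injective⇒IsSignedPerm α (hasAscentSet⇒injective ascents) ,
                   avoids true (λ ()) ∷ avoids true (λ ()) ∷ avoids true (λ ()) ∷ avoids false (λ ()) ∷ []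
      where
      avoids : ∀ {b₀ b₁} o → b₀ ∧ b₁ ≢ o → ¬ Contains α (pattern₂ b₀ b₁ o)
      avoids o b₀∧b₁≢o = avoids-pattern₂ o α ascents λ bar-x bar-y →
        subst₂ (λ u v → u ∧ v ≢ o) (sym bar-x) (sym bar-y) b₀∧b₁≢o

module _ {b : ℕ → Bool} {f : ℕ → ℕ} (f<n : ∀ {x} → x < n → f x < n) where

  wordOf-ascents : ∀ {asc} → HasAscentSet asc f n → HasAscentSet asc (value (wordOf b f f<n)) n
  wordOf-ascents = HasAscentSet-congʳ (sym ∘ value-wordOf f<n)

  ≡wordOf : ∀ {asc} (α : Word n) → HasAscentSet asc (value α) n → HasAscentSet asc f n →
            (∀ {x} → x < n → bar α x ≡ b x) → α ≡ wordOf b f f<n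
  ≡wordOf α α-ascents f-ascents same-bar = word-≡
    (λ x<n → trans (same-bar x<n) (sym (bar-wordOf f<n x<n)))
    (λ x<n → trans (hasAscentSet-unique α-ascents f-ascents (value<n α) f<n x<n)
                   (sym (value-wordOf f<n x<n)))

wordOf-injectiveˡ : ∀ {b b′ f f′} {f<n : ∀ {x} → x < n → f x < n} {f′<n : ∀ {x} → x < n → f′ x < n} →
                    wordOf b f f<n ≡ wordOf b′ f′ f′<n → ∀ {x} → x < n → b x ≡ b′ x
wordOf-injectiveˡ {f<n = f<n} {f′<n} eq x<n =
  trans (sym (bar-wordOf f<n x<n)) (trans (cong (λ α → bar α _) eq) (bar-wordOf f′<n x<n))

descending<n : ∀ {x} → x < n → n ∸ suc x < n
descending<n x<n = ∸-monoʳ-< (s≤s z≤n) x<n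

descending-ascents : HasAscentSet (λ _ _ → false) (λ x → n ∸ suc x) n
descending-ascents = hasAscentSet λ x<y y<n → ∸-monoʳ-< (s≤s x<y) y<n

bCount-pb1b2 : ∀ n → bCount n (T₁ ∷ʳ pb1b2) (2 ^ n)
bCount-pb1b2 n = HasCard-cong (λ α → mk⇔ to (from α)) (HasCard-image signed injective (HasCard-Vec n))
  where
  signed : Vec Bool n → Word n
  signed v = wordOf (lookupℕ false v) (λ x → n ∸ suc x) descending<n
  injective : ∀ {v v′} → ⊤ → ⊤ → signed v ≡ signed v′ → v ≡ v′
  injective _ _ eq = lookupℕ-injective (wordOf-injectiveˡ eq)
  to : ∀ {α} → (∃ λ v → ⊤ × signed v ≡ α) → InB n (T₁ ∷ʳ pb1b2) α
  to (v , _ , refl) =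
    Equivalence.from (InB-pb1b2⇔descending (signed v)) (wordOf-ascents descending<n descending-ascents)
  from : ∀ α → InB n (T₁ ∷ʳ pb1b2) α → ∃ λ v → ⊤ × signed v ≡ α
  from α α∈B = map barred α , tt ,
    sym (≡wordOf descending<n α (Equivalence.to (InB-pb1b2⇔descending α) α∈B) descending-ascents λ _ → refl)

-- Blocks of barred letters

opaque
  inBlock : ℕ × ℕ → ℕ → Bool
  inBlock (s , e) x = (s ≤ᵇ x) ∧ (x <ᵇ e)

data BlockView (s e x : ℕ) : Bool → Set where
  before : x < s → BlockView s e x false
  inside : s ≤ x → x < e → BlockView s e x true
  after  : e ≤ x → BlockView s e x false

opaque
  unfolding inBlock

  blockView : ∀ s e x → BlockView s e x (inBlock (s , e) x)
  blockView s e x with s ≤ᵇ x | ≤ᵇ-reflects-≤ s x | x <ᵇ e | <ᵇ-reflects-< x e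
  ... | false | ofⁿ s≰x | _     | _        = before (≰⇒> s≰x)
  ... | true  | ofʸ s≤x | true  | ofʸ x<e  = inside s≤x x<e
  ... | true  | ofʸ _   | false | ofⁿ x≮e  = after (≮⇒≥ x≮e)

module _ {s e x : ℕ} where

  BlockView-unique : ∀ {b b′} → BlockView s e x b → BlockView s e x b′ → b ≡ b′
  BlockView-unique (inside s≤x _)   (before x<s)     = ⊥-elim (<⇒≱ x<s s≤x)
  BlockView-unique (inside _ x<e)   (after e≤x)      = ⊥-elim (<⇒≱ x<e e≤x)
  BlockView-unique (before x<s)     (inside s≤x _)   = ⊥-elim (<⇒≱ x<s s≤x)
  BlockView-unique (after e≤x)      (inside _ x<e)   = ⊥-elim (<⇒≱ x<e e≤x)
  BlockView-unique (inside _ _)     (inside _ _)     = refl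
  BlockView-unique (before _)       (before _)       = refl
  BlockView-unique (before _)       (after _)        = refl
  BlockView-unique (after _)        (before _)       = refl
  BlockView-unique (after _)        (after _)        = refl

  inBlock-view : ∀ {b} → BlockView s e x b → inBlock (s , e) x ≡ b
  inBlock-view = BlockView-unique (blockView s e x)

  inBlock⇒inside : inBlock (s , e) x ≡ true → s ≤ x × x < e
  inBlock⇒inside eq with inBlock (s , e) x | blockView s e x
  ... | true | inside s≤x x<e = s≤x , x<e

NonEmptyBlock : ℕ → ℕ × ℕ → Set
NonEmptyBlock n (s , e) = s < e × e ≤ n

-- Blocks [s, e) of positions in [0, n); the empty block is coded by (0 , 0) only.
Block : ℕ → ℕ × ℕ → Set
Block n c = c ≡ (0 , 0) ⊎ NonEmptyBlock n c

Block⇒end≤n : ∀ {s e} → Block n (s , e) → e ≤ n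
Block⇒end≤n (inj₁ refl)      = z≤n
Block⇒end≤n (inj₂ (_ , e≤n)) = e≤n

HasCard-NonEmptyBlock : ∀ n → HasCard (NonEmptyBlock n) (suc n C 2)
HasCard-NonEmptyBlock zero = HasCard-∅ λ { (_ , zero) (() , _) ; (_ , suc _) (_ , ()) }
HasCard-NonEmptyBlock (suc n) = subst (HasCard (NonEmptyBlock (suc n))) pascal
  (HasCard-cong split (HasCard-⊎ (λ { _ (_ , _ , refl) (_ , 1+n≤n) → 1+n≰n 1+n≤n })
                                 (HasCard-image (_, suc n) (λ _ _ → cong proj₁) (HasCard-< (suc n)))
                                 (HasCard-NonEmptyBlock n)))
  where
  pascal : suc n + suc n C 2 ≡ suc (suc n) C 2
  pascal = trans (cong (_+ suc n C 2) (sym (nC1≡n (suc n)))) (nCk+nC[k+1]≡[n+1]C[k+1] (suc n) 1)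
  split : ∀ c → ((∃ λ s → s < suc n × (s , suc n) ≡ c) ⊎ NonEmptyBlock n c) ⇔ NonEmptyBlock (suc n) c
  split (s , e) = mk⇔ to from
    where
    to : (∃ λ s′ → s′ < suc n × (s′ , suc n) ≡ (s , e)) ⊎ NonEmptyBlock n (s , e) →
         NonEmptyBlock (suc n) (s , e)
    to (inj₁ (_ , s<1+n , refl)) = s<1+n , ≤-refl
    to (inj₂ (s<e , e≤n))        = s<e , m≤n⇒m≤1+n e≤n
    from : NonEmptyBlock (suc n) (s , e) →
           (∃ λ s′ → s′ < suc n × (s′ , suc n) ≡ (s , e)) ⊎ NonEmptyBlock n (s , e)
    from (s<e , e≤1+n) with m≤n⇒m<n∨m≡n e≤1+n
    ... | inj₁ (s≤s e≤n) = inj₂ (s<e , e≤n)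
    ... | inj₂ refl      = inj₁ (s , s<e , refl)

Block-suc : ∀ {c} → Block n c → Block (suc n) c
Block-suc (inj₁ c≡00)          = inj₁ c≡00
Block-suc (inj₂ (s<e , e≤n)) = inj₂ (s<e , m≤n⇒m≤1+n e≤n)

HasCard-Block : ∀ n → HasCard (Block n) (1 + suc n C 2)
HasCard-Block n = HasCard-⊎ (λ { _ refl (() , _) }) (HasCard-singleton (0 , 0)) (HasCard-NonEmptyBlock n)

-- The descending word n−1 ⋯ 1 0 with the positions in [s, e) reversed.
blockValue : ℕ → ℕ × ℕ → ℕ → ℕ
blockValue n (s , e) x = if inBlock (s , e) x then n ∸ e + (x ∸ s) else n ∸ suc x

inside-value< : ∀ {s e x} → s ≤ x → x < e → e ≤ n → n ∸ e + (x ∸ s) < n ∸ s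
inside-value< {n} {s} {e} {x} s≤x x<e e≤n = begin-strict
  n ∸ e + (x ∸ s) <⟨ +-monoʳ-< (n ∸ e) (∸-monoˡ-< x<e s≤x) ⟩
  n ∸ e + (e ∸ s) ≡⟨ +-∸-assoc (n ∸ e) (≤-trans s≤x (<⇒≤ x<e)) ⟨
  (n ∸ e + e) ∸ s ≡⟨ cong (_∸ s) (m∸n+n≡m e≤n) ⟩
  n ∸ s           ∎
  where open ≤-Reasoning

n∸e+x<n : ∀ {e x} → x < e → x < n → n ∸ e + x < n
n∸e+x<n {n} {e} {x} x<e x<n with ≤-total e n
... | inj₁ e≤n = begin-strict
  n ∸ e + x <⟨ +-monoʳ-< (n ∸ e) x<e ⟩
  n ∸ e + e ≡⟨ m∸n+n≡m e≤n ⟩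
  n         ∎
  where open ≤-Reasoning
... | inj₂ n≤e = subst (λ m → m + x < n) (sym (m≤n⇒m∸n≡0 n≤e)) x<n

blockValue<n : ∀ c {x} → x < n → blockValue n c x < n
blockValue<n {n} (s , e) {x} x<n with inBlock (s , e) x | blockView s e x
... | true  | inside _ x<e = ≤-<-trans (+-monoʳ-≤ (n ∸ e) (m∸n≤m x s)) (n∸e+x<n x<e x<n)
... | false | _            = descending<n x<n

blockValue-ascents : ∀ {s e} → e ≤ n → HasAscentSet (bothBarred (inBlock (s , e))) (blockValue n (s , e)) n
blockValue-ascents {n} {s} {e} e≤n = hasAscentSet λ {x} {y} → compare x y
  where
  compare : ∀ x y → x < y → y < n →
            Ordered (inBlock (s , e) x ∧ inBlock (s , e) y) (blockValue n (s , e) x) (blockValue n (s , e) y)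
  compare x y x<y y<n with inBlock (s , e) x | blockView s e x | inBlock (s , e) y | blockView s e y
  ... | true  | inside s≤x _ | true  | inside _ _     = +-monoʳ-< (n ∸ e) (∸-monoˡ-< x<y s≤x)
  ... | true  | inside s≤x _ | false | before y<s     = ⊥-elim (<-asym (≤-<-trans s≤x x<y) y<s)
  ... | true  | inside _ _   | false | after e≤y      = <-≤-trans (∸-monoʳ-< (s≤s e≤y) y<n) (m≤m+n (n ∸ e) _)
  ... | false | before x<s   | true  | inside s≤y y<e = <-≤-trans (inside-value< s≤y y<e e≤n) (∸-monoʳ-≤ n x<s)
  ... | false | after e≤x    | true  | inside _ y<e   = ⊥-elim (<-asym (≤-<-trans e≤x x<y) y<e)
  ... | false | _            | false | _              = ∸-monoʳ-< (s≤s x<y) y<n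

Convex : (ℕ → Bool) → ℕ → Set
Convex b n = ∀ {x y z} → x < y → y < z → z < n → b x ≡ true → b z ≡ true → b y ≡ true

-- An unbarred letter between two barred ones would lie below the first and above the last,
-- while the two barred letters must form an ascent.
bothBarred⇒convex : ∀ {b f} → HasAscentSet (bothBarred b) f n → Convex b n
bothBarred⇒convex {n} {b} {f} ascents {x} {y} {z} x<y y<z z<n bx bz with b y in by
... | true  = refl
... | false = ⊥-elim (<-asym (<-trans fz<fy fy<fx) fx<fz)
  where
  y<n = <-trans y<z z<n
  ordered-by-bars : ∀ {u v bu bv} → u < v → v < n → b u ≡ bu → b v ≡ bv → Ordered (bu ∧ bv) (f u) (f v)
  ordered-by-bars {u} {v} u<v v<n bu bv =
    subst (λ o → Ordered o (f u) (f v)) (cong₂ _∧_ bu bv) (ordered ascents u<v v<n)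
  fy<fx = ordered-by-bars x<y y<n bx by
  fz<fy = ordered-by-bars y<z z<n by bz
  fx<fz = ordered-by-bars (<-trans x<y y<z) z<n bx bz

false≢true : false ≢ true
false≢true ()

inBlock-suc : ∀ {s e x} → x < e → inBlock (s , e) x ≡ inBlock (s , suc e) x
inBlock-suc {s} {e} {x} x<e with inBlock (s , e) x | blockView s e x
... | _ | before x<s   = sym (inBlock-view (before x<s))
... | _ | inside s≤x _ = sym (inBlock-view (inside s≤x (m<n⇒m<1+n x<e)))
... | _ | after e≤x    = ⊥-elim (<⇒≱ x<e e≤x)

agree-suc : ∀ {b : ℕ → Bool} {c} → (∀ {x} → x < n → b x ≡ inBlock c x) → b n ≡ inBlock c n →
            ∀ {x} → x < suc n → b x ≡ inBlock c x
agree-suc agree agree-n x<1+n with m<1+n⇒m<n∨m≡n x<1+n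
... | inj₁ x<n  = agree x<n
... | inj₂ refl = agree-n

convex⇒block : ∀ b n → Convex b n → ∃ λ c → Block n c × (∀ {x} → x < n → b x ≡ inBlock c x)
convex⇒block b zero    _      = (0 , 0) , inj₁ refl , λ ()
convex⇒block b (suc n) convex
  with convex⇒block b n (λ x<y y<z z<n → convex x<y y<z (m<n⇒m<1+n z<n)) | b n in bn
... | (s , e) , block , agree | false =
  (s , e) , Block-suc block ,
  agree-suc agree (trans bn (sym (inBlock-view (after (Block⇒end≤n block)))))
... | _ , inj₁ refl , agree | true =
  (n , suc n) , inj₂ (n<1+n n , ≤-refl) ,
  agree-suc (λ x<n → trans (agree x<n) (trans (inBlock-view (after z≤n)) (sym (inBlock-view (before x<n)))))
            (trans bn (sym (inBlock-view (inside ≤-refl (n<1+n n)))))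
... | (s , e) , inj₂ (s<e , e≤n) , agree | true with m≤n⇒m<n∨m≡n e≤n
...   | inj₁ e<n  = ⊥-elim (false≢true (trans (sym e-unbarred) e-barred))
  where
  e-unbarred = trans (agree e<n) (inBlock-view (after ≤-refl))
  e-barred = convex s<e e<n (n<1+n n) (trans (agree (<-trans s<e e<n)) (inBlock-view (inside ≤-refl s<e))) bn
...   | inj₂ refl =
  (s , suc n) , inj₂ (m<n⇒m<1+n s<e , ≤-refl) ,
  agree-suc (λ x<n → trans (agree x<n) (inBlock-suc x<n))
            (trans bn (sym (inBlock-view (inside (<⇒≤ s<e) (n<1+n n)))))

sameBlock⇒⊆ : ∀ {s e s′ e′} → (∀ {x} → x < n → inBlock (s , e) x ≡ inBlock (s′ , e′) x) →
              NonEmptyBlock n (s , e) → s′ ≤ s × e ≤ e′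
sameBlock⇒⊆ {e = suc l} same (s<e@(s≤s s≤l) , e≤n) =
  proj₁ (inBlock⇒inside (trans (sym (same (<-≤-trans s<e e≤n))) (inBlock-view (inside ≤-refl s<e)))) ,
  proj₂ (inBlock⇒inside (trans (sym (same (<-≤-trans (n<1+n l) e≤n))) (inBlock-view (inside s≤l (n<1+n l)))))

inBlock-injective : ∀ {c c′} → Block n c → Block n c′ → (∀ {x} → x < n → inBlock c x ≡ inBlock c′ x) → c ≡ c′
inBlock-injective (inj₁ refl) (inj₁ refl) _ = refl
inBlock-injective {c′ = s′ , e′} (inj₁ refl) (inj₂ (s′<e′ , e′≤n)) same = ⊥-elim (false≢true (begin
  false                 ≡⟨ inBlock-view (after z≤n) ⟨
  inBlock (0 , 0) s′    ≡⟨ same (<-≤-trans s′<e′ e′≤n) ⟩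
  inBlock (s′ , e′) s′  ≡⟨ inBlock-view (inside ≤-refl s′<e′) ⟩
  true                  ∎))
  where open ≡-Reasoning
inBlock-injective (inj₂ nonempty) (inj₁ refl) same =
  sym (inBlock-injective (inj₁ refl) (inj₂ nonempty) (sym ∘ same))
inBlock-injective (inj₂ nonempty) (inj₂ nonempty′) same
  with sameBlock⇒⊆ same nonempty | sameBlock⇒⊆ (sym ∘ same) nonempty′
... | s′≤s , e≤e′ | s≤s′ , e′≤e = cong₂ _,_ (≤-antisym s≤s′ s′≤s) (≤-antisym e≤e′ e′≤e)

bCount-pb2b1 : ∀ n → bCount n (T₁ ∷ʳ pb2b1) (1 + suc n C 2)
bCount-pb2b1 n = HasCard-cong (λ α → mk⇔ to (from α)) (HasCard-image blockWord injective (HasCard-Block n))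
  where
  blockWord : ℕ × ℕ → Word n
  blockWord c = wordOf (inBlock c) (blockValue n c) (blockValue<n c)
  injective : ∀ {c c′} → Block n c → Block n c′ → blockWord c ≡ blockWord c′ → c ≡ c′
  injective block block′ eq = inBlock-injective block block′ (wordOf-injectiveˡ eq)
  to : ∀ {α} → (∃ λ c → Block n c × blockWord c ≡ α) → InB n (T₁ ∷ʳ pb2b1) α
  to (c , block , refl) = Equivalence.from (InB-pb2b1⇔bothBarred (blockWord c))
    (HasAscentSet-bothBarred-cong (sym ∘ bar-wordOf (blockValue<n c))
      (wordOf-ascents (blockValue<n c) (blockValue-ascents (Block⇒end≤n block))))
  from : ∀ α → InB n (T₁ ∷ʳ pb2b1) α → ∃ λ c → Block n c × blockWord c ≡ α
  from α α∈B with Equivalence.to (InB-pb2b1⇔bothBarred α) α∈B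
  ... | ascents with convex⇒block (bar α) n (bothBarred⇒convex ascents)
  ... | c , block , agree =
    c , block , sym (≡wordOf (blockValue<n c) α (HasAscentSet-bothBarred-cong agree ascents)
                             (blockValue-ascents (Block⇒end≤n block)) agree)

mainTheorem3 : (∀ (n : ℕ) → bCount n (T₁ ∷ʳ pb1b2) (2 ^ n))
    × (∀ (n : ℕ) → 2 ≤ n → bCount n (T₁ ∷ʳ pb2b1) (1 + ((n + 1) C 2)))
mainTheorem3 =
  bCount-pb1b2 ,
  λ n _ → subst (λ m → bCount n (T₁ ∷ʳ pb2b1) (1 + m C 2)) (+-comm 1 n) (bCount-pb2b1 n)
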